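{- Let $\mathbb{P}_{\mathfrak{p}}=\langle\{\phi\},\chi,\mathsf{H},\mathbb{E},\mathfrak{p}\rangle$ be a probabilistic abduction problem, $\mathbf{V}$ the set of variables occurring in it, and $\tau$ an $\mathcal{L}_{\mathsf{CPL}}$-term built from literals in $\mathsf{H}$. Then: (1) $\tau$ is a solution to $\mathbb{P}_{\mathfrak{p}}$ iff $\Xi_{\mathfrak{p}}\cup\{\neg\triangle\neg\mathsf{Pr}(\phi\wedge\tau)\}\not\models_{\mathsf{FP}}\bot$ and $\mathsf{FP}\models\mathsf{Pr}(\phi\wedge\tau)\rightarrow\mathsf{Pr}(\chi)$; (2) $\tau$ is a preferred solution to $\mathbb{P}_{\mathfrak{p}}$ iff the two conditions of (1) hold and, in addition, $\Xi_{\mathfrak{p}}\cup\{\mathsf{Pr}(\sigma)\rightarrow\mathsf{Pr}(\tau)\}\not\models_{\mathsf{FP}}\bot$ for every solution $\sigma$ to $\mathbb{P}_{\mathfrak{p}}$.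
   Context: $\mathcal{L}_{\mathsf{CPL}}$ is the set of classical propositional formulas over a countable set of variables built with $\neg,\wedge,\vee$, with classical entailment $\models_{\mathsf{CPL}}$; an $\mathcal{L}_{\mathsf{CPL}}$-term is a conjunction of literals. Language $\mathcal{L}^{\mathbb{Q}}_{\mathsf{Pr}}$ of FP: $\alpha ::= \mathsf{Pr}(\psi)\mid \mathsf{Pr}(\psi)\diamond\overline{c}\mid\neg\alpha\mid\triangle\alpha\mid\alpha\odot\alpha\mid\alpha\oplus\alpha\mid\alpha\rightarrow\alpha$ with $\psi\in\mathcal{L}_{\mathsf{CPL}}$, $c\in\mathbb{Q}\cap[0,1]$, $\diamond\in\{\le,<,>,\ge\}$. A probabilistic model for a finite $\mathbf{V}$ is $\mathfrak{M}=\langle 2^{\mathbf{V}},\mu\rangle$ with $\mu$ a probability measure on the power set of $2^{\mathbf{V}}$; $\|p\|=\{X\subseteq\mathbf{V}:p\in X\}$, $\|\neg\psi\|$ complement, $\|\psi\wedge\psi'\|$ intersection, $\|\psi\vee\psi'\|$ union. Interpretation: $\mathcal{I}_{\mathfrak{M}}(\mathsf{Pr}(\psi))=\mu(\|\psi\|)$; $\mathcal{I}_{\mathfrak{M}}(\mathsf{Pr}(\psi)\diamond\overline{c})=1$ if $\mu(\|\psi\|)\diamond c$, else $0$; $\mathcal{I}(\neg\alpha)=1-\mathcal{I}(\alpha)$; $\mathcal{I}(\triangle\alpha)=1$ if $\mathcal{I}(\alpha)=1$ else $0$; $\mathcal{I}(\alpha\odot\beta)=\max(0,\mathcal{I}(\alpha)+\mathcal{I}(\beta)-1)$;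 $\mathcal{I}(\alpha\oplus\beta)=\min(1,\mathcal{I}(\alpha)+\mathcal{I}(\beta))$; $\mathcal{I}(\alpha\rightarrow\beta)=\min(1,1-\mathcal{I}(\alpha)+\mathcal{I}(\beta))$. $\Gamma\models_{\mathsf{FP}}\bot$ means no probabilistic model (for the variables of $\Gamma$) gives value $1$ to all of $\Gamma$; $\mathsf{FP}\models\alpha$ means $\alpha$ has value $1$ in every probabilistic model. $\mathsf{Pr}(\psi)\approx\overline{c}$ abbreviates $(\mathsf{Pr}(\psi)\ge\overline{c})\odot(\mathsf{Pr}(\psi)\le\overline{c})$. A probabilistic abduction problem (PrAP) is $\mathbb{P}_{\mathfrak{p}}=\langle\Phi,\chi,\mathsf{H},\mathbb{E},\mathfrak{p}\rangle$ where $\Phi\cup\{\chi\}\cup\mathbb{E}\subseteq\mathcal{L}_{\mathsf{CPL}}$ is finite, the variables of $\mathbb{E}$ occur in $\Phi\cup\{\chi\}$, $\mathsf{H}$ is a finite set of literals whose variables occur in $\Phi\cup\{\chi\}$, and $\mathfrak{p}:\mathbb{E}\to[0,1]\cap\mathbb{Q}$. $\mu$ (on $2^{\mathbf{V}}$) is coherent with $\mathfrak{p}$ iff $\mu(\|\psi\|)=\mathfrak{p}(\psi)$ for all $\psi\in\mathbb{E}$. For $\Phi=\{\phi\}$: a solution is an $\mathcal{L}_{\mathsf{CPL}}$-term $\tau$ built from literals in $\mathsf{H}$ with $\phi,\tau\models_{\mathsf{CPL}}\chi$ such that some model $\langle 2^{\mathbf{V}},\mu\rangle$ with $\mu$ coherent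 with $\mathfrak{p}$ has $\mu(\|\phi\wedge\tau\|)>0$; a solution $\tau$ is preferred iff for every other solution $\sigma$ there is a model $\langle 2^{\mathbf{V}},\mu\rangle$ with $\mu$ coherent with $\mathfrak{p}$ and $\mu(\|\tau\|)\ge\mu(\|\sigma\|)$. The FP-counterpart of $\mathfrak{p}$ is $\Xi_{\mathfrak{p}}=\{\mathsf{Pr}(\psi)\approx\overline{c}:\psi\in\mathbb{E},\ \mathfrak{p}(\psi)=c\}$.
   Formalization: The probability measures μ of all probabilistic models take rational values instead of real values in [0,1]. -}

module Defs where

open import Data.Bool using (Bool; true; false; if_then_else_; not; _∧_; _∨_)
open import Data.Nat using (ℕ; _≡ᵇ_)
open import Data.List using (List; []; _∷_; _++_; map; filter; foldr; concatMap; length)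
open import Data.List.Membership.Propositional using (_∈_)
open import Data.Vec using (Vec; []; _∷_)
open import Data.Rational using (ℚ; 0ℚ; 1ℚ; _+_; _-_; _≤ᵇ_; _⊔_; _⊓_; _≤_; _<_; _≟_)
open import Data.Product using (Σ; _×_; _,_)
open import Relation.Binary.PropositionalEquality using (_≡_)
open import Relation.Nullary.Decidable using (⌊_⌋)
open import Data.List.Relation.Unary.All using (All)
open import Function.Bundles using (_⇔_)

data Fml : Set where
  var  : ℕ → Fml
  neg  : Fml → Fml
  _∧ᶠ_ : Fml → Fml → Fml
  _∨ᶠ_ : Fml → Fml → Fml

evalᶜ : (ℕ → Bool) → Fml → Bool
evalᶜ ρ (var x)   = ρ x
evalᶜ ρ (neg ψ)   = not (evalᶜ ρ ψ)
evalᶜ ρ (ψ ∧ᶠ ψ') = evalᶜ ρ ψ ∧ evalᶜ ρ ψ'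
evalᶜ ρ (ψ ∨ᶠ ψ') = evalᶜ ρ ψ ∨ evalᶜ ρ ψ'

_,_⊨CPL_ : Fml → Fml → Fml → Set
ψ₁ , ψ₂ ⊨CPL χ = (ρ : ℕ → Bool) → evalᶜ ρ ψ₁ ≡ true → evalᶜ ρ ψ₂ ≡ true → evalᶜ ρ χ ≡ true

varsᶠ : Fml → List ℕ
varsᶠ (var x)   = x ∷ []
varsᶠ (neg ψ)   = varsᶠ ψ
varsᶠ (ψ ∧ᶠ ψ') = varsᶠ ψ ++ varsᶠ ψ'
varsᶠ (ψ ∨ᶠ ψ') = varsᶠ ψ ++ varsᶠ ψ'

data Literal : Set where
  pos  : ℕ → Literal
  negl : ℕ → Literal

litFml : Literal → Fml
litFml (pos x)  = var x
litFml (negl x) = neg (var x)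

litVar : Literal → ℕ
litVar (pos x)  = x
litVar (negl x) = x

data IsTermOver (H : List Literal) : Fml → Set where
  lit  : ∀ {l} → l ∈ H → IsTermOver H (litFml l)
  conj : ∀ {τ τ'} → IsTermOver H τ → IsTermOver H τ' → IsTermOver H (τ ∧ᶠ τ')

-- the states 2^V: one Boolean per entry of V
State : List ℕ → Set
State V = Vec Bool (length V)

allStates : (n : ℕ) → List (Vec Bool n)
allStates ℕ.zero    = [] ∷ []
allStates (ℕ.suc n) = concatMap (λ w → (true ∷ w) ∷ (false ∷ w) ∷ []) (allStates n)

-- the assignment induced by a state (variables outside V get false; never used)
assign : (V : List ℕ) → Vec Bool (length V) → ℕ → Bool
assign []      []      x = false
assign (y ∷ V) (b ∷ w) x = if x ≡ᵇ y then b else assign V w x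

sumℚ : List ℚ → ℚ
sumℚ = foldr _+_ 0ℚ

-- a probability measure on the (finite) power set of 2^V, given by its
-- point masses (rational-valued)
record ProbModel (V : List ℕ) : Set where
  field
    μ       : State V → ℚ
    nonneg  : (w : State V) → 0ℚ ≤ μ w
    total   : sumℚ (map μ (allStates (length V))) ≡ 1ℚ

measure : {V : List ℕ} → ProbModel V → Fml → ℚ
measure {V} M ψ =
  sumℚ (map (ProbModel.μ M)
            (filter (λ w → evalᶜ (assign V w) ψ Data.Bool.≟ true) (allStates (length V))))

data Cmp : Set where
  ≤c <c >c ≥c : Cmp

data PrF : Set where
  Pr    : Fml → PrF
  Prc   : Fml → Cmp → ℚ → PrF
  ¬ₚ_   : PrF → PrF
  △_    : PrF → PrF
  _⊙_   : PrF → PrF → PrF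
  _⊕_   : PrF → PrF → PrF
  _⇒_   : PrF → PrF → PrF

varsᴾ : PrF → List ℕ
varsᴾ (Pr ψ)      = varsᶠ ψ
varsᴾ (Prc ψ _ _) = varsᶠ ψ
varsᴾ (¬ₚ α)      = varsᴾ α
varsᴾ (△ α)       = varsᴾ α
varsᴾ (α ⊙ β)     = varsᴾ α ++ varsᴾ β
varsᴾ (α ⊕ β)     = varsᴾ α ++ varsᴾ β
varsᴾ (α ⇒ β)     = varsᴾ α ++ varsᴾ β

ind : Bool → ℚ
ind true  = 1ℚ
ind false = 0ℚ

cmpᵇ : Cmp → ℚ → ℚ → Bool
cmpᵇ ≤c a c = a ≤ᵇ c
cmpᵇ <c a c = not (c ≤ᵇ a)
cmpᵇ >c a c = not (a ≤ᵇ c)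
cmpᵇ ≥c a c = c ≤ᵇ a

⟦_⟧ : {V : List ℕ} → PrF → ProbModel V → ℚ
⟦ Pr ψ ⟧ M      = measure M ψ
⟦ Prc ψ d c ⟧ M = ind (cmpᵇ d (measure M ψ) c)
⟦ ¬ₚ α ⟧ M      = 1ℚ - ⟦ α ⟧ M
⟦ △ α ⟧ M       = ind ⌊ ⟦ α ⟧ M ≟ 1ℚ ⌋
⟦ α ⊙ β ⟧ M     = 0ℚ ⊔ (⟦ α ⟧ M + ⟦ β ⟧ M - 1ℚ)
⟦ α ⊕ β ⟧ M     = 1ℚ ⊓ (⟦ α ⟧ M + ⟦ β ⟧ M)
⟦ α ⇒ β ⟧ M     = 1ℚ ⊓ (1ℚ - ⟦ α ⟧ M + ⟦ β ⟧ M)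

_≈ₚ_ : Fml → ℚ → PrF
ψ ≈ₚ c = Prc ψ ≥c c ⊙ Prc ψ ≤c c

varsΓ : List PrF → List ℕ
varsΓ []      = []
varsΓ (α ∷ Γ) = varsᴾ α ++ varsΓ Γ

FPSat : List PrF → Set
FPSat Γ = Σ (ProbModel (varsΓ Γ)) λ M → All (λ α → ⟦ α ⟧ M ≡ 1ℚ) Γ

FPValid : PrF → Set
FPValid α = (V : List ℕ) → All (_∈ V) (varsᴾ α) → (M : ProbModel V) → ⟦ α ⟧ M ≡ 1ℚ

record PrAP : Set where
  field
    φ  : Fml
    χ  : Fml
    H  : List Literal
    E  : List Fml
    𝔭  : Fml → ℚ
    E-vars : All (λ ψ → All (_∈ varsᶠ φ ++ varsᶠ χ) (varsᶠ ψ)) E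
    H-vars : All (λ l → litVar l ∈ varsᶠ φ ++ varsᶠ χ) H
    𝔭-range : All (λ ψ → (0ℚ ≤ 𝔭 ψ) × (𝔭 ψ ≤ 1ℚ)) E

module _ (P : PrAP) where
  open PrAP P

  varsP : List ℕ
  varsP = varsᶠ φ ++ varsᶠ χ ++ Data.List.concatMap varsᶠ E ++ map litVar H

  Coherent : ProbModel varsP → Set
  Coherent M = All (λ ψ → measure M ψ ≡ 𝔭 ψ) E

  IsSolution : Fml → Set
  IsSolution τ = IsTermOver H τ × (φ , τ ⊨CPL χ)
               × Σ (ProbModel varsP) (λ M → Coherent M × (0ℚ < measure M (φ ∧ᶠ τ)))

  IsPreferred : Fml → Set
  IsPreferred τ = IsSolution τ ×
    ((σ : Fml) → IsSolution σ →
       Σ (ProbModel varsP) (λ M → Coherent M × (measure M σ ≤ measure M τ)))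

  Ξ : List PrF
  Ξ = map (λ ψ → ψ ≈ₚ 𝔭 ψ) E

module Submission where

open import Defs
open import Data.List using (_∷_; []; _++_)
open import Data.Product using (_×_)
open import Data.Rational using (ℚ)
open import Function.Bundles using (_⇔_)

open import Algebra.Bundles using (CommutativeMonoid)
open import Data.Bool using (Bool; true; false; if_then_else_; T)
import Data.Bool as Bool
open import Data.Bool.Properties using (T-≡)
open import Data.Empty using (⊥-elim)
open import Data.List using (List; map; filter; concatMap; length)
open import Data.List.Membership.Propositional using (_∈_)
open import Data.List.Membership.Propositional.Properties using (∈-++⁺ˡ; ∈-++⁺ʳ; ∈-++⁻; ∈-map⁻)
open import Data.List.Relation.Binary.Subset.Propositional using (_⊆_)
open import Data.List.Relation.Binary.Subset.Propositional.Properties using (xs⊆xs++ys; xs⊆ys++xs)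
open import Data.List.Relation.Unary.All as All using (All)
import Data.List.Relation.Unary.All.Properties as All
open import Data.List.Relation.Unary.Any using (here; there)
open import Data.Nat using (ℕ; suc; _≡ᵇ_)
open import Data.Nat.Properties using (≡ᵇ⇒≡; ≡⇒≡ᵇ)
open import Data.Product using (Σ; _,_)
open import Data.Rational using (0ℚ; 1ℚ; _+_; _-_; _⊔_; _⊓_; _≤_; _<_; _≤ᵇ_; _≟_; _<?_)
import Data.Rational.Properties as QP
open import Data.Rational.Solver using (module +-*-Solver)
open import Data.Sum using ([_,_]; inj₁; inj₂)
open import Data.Vec using (Vec) renaming ([] to []ᵛ; _∷_ to _∷ᵛ_)
open import Data.Vec.Properties using (≡-dec)
open import Function using (_∘_)
open import Function.Bundles using (mk⇔; Equivalence)
open import Relation.Binary.Definitions using (DecidableEquality)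
open import Relation.Binary.PropositionalEquality using (_≡_; refl; sym; trans; cong; cong₂; subst; subst₂; module ≡-Reasoning)
open import Relation.Nullary using (yes; no; does)
open import Relation.Nullary.Decidable using (⌊_⌋)

open import Algebra.Properties.CommutativeSemigroup (CommutativeMonoid.commutativeSemigroup QP.+-0-commutativeMonoid)
  using (interchange)

-- Each FP condition of the theorem is a statement about the measure μ of a model: Ξ_𝔭 holds
-- iff μ is coherent with 𝔭, ¬△¬Pr(ψ) holds iff μ‖ψ‖ > 0, and Pr(ψ) → Pr(ψ′) holds iff
-- μ‖ψ‖ ≤ μ‖ψ′‖.  What remains is the mismatch of variable sets (FP-satisfiability is over the
-- variables of the premises, solutions over those of the problem): pushing μ forward along the
-- map 2^V → 2^V′ that restricts or extends states by false preserves μ‖ψ‖ whenever the variables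
-- of ψ lie in V′, so models transfer in both directions.  Finally, FP-validity of
-- Pr(φ ∧ τ) → Pr(χ) is φ, τ ⊨ χ: monotonicity of μ gives one direction, and a point mass at a
-- countermodel refutes validity in the other.

open ≡-Reasoning
open Equivalence using (to; from)

private
  variable
    A B : Set

∑ : List A → (A → ℚ) → ℚ
∑ xs g = sumℚ (map g xs)

when : Bool → ℚ → ℚ
when b q = if b then q else 0ℚ

∑-cong : (xs : List A) {g h : A → ℚ} → (∀ x → g x ≡ h x) → ∑ xs g ≡ ∑ xs h
∑-cong []       g≡h = refl
∑-cong (x ∷ xs) g≡h = cong₂ _+_ (g≡h x) (∑-cong xs g≡h)

∑-zero : (xs : List A) → ∑ xs (λ _ → 0ℚ) ≡ 0ℚ
∑-zero []       = refl
∑-zero (x ∷ xs) = cong (0ℚ +_) (∑-zero xs)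

∑-distrib-+ : (xs : List A) (g h : A → ℚ) → ∑ xs (λ x → g x + h x) ≡ ∑ xs g + ∑ xs h
∑-distrib-+ []       g h = refl
∑-distrib-+ (x ∷ xs) g h =
  trans (cong ((g x + h x) +_) (∑-distrib-+ xs g h)) (interchange (g x) (h x) _ _)

∑-swap : (xs : List A) (ys : List B) (F : A → B → ℚ) →
  ∑ xs (λ x → ∑ ys (F x)) ≡ ∑ ys (λ y → ∑ xs (λ x → F x y))
∑-swap []       ys F = sym (∑-zero ys)
∑-swap (x ∷ xs) ys F =
  trans (cong (∑ ys (F x) +_) (∑-swap xs ys F))
        (sym (∑-distrib-+ ys (F x) (λ y → ∑ xs (λ x′ → F x′ y))))

∑-nonneg : (xs : List A) {g : A → ℚ} → (∀ x → 0ℚ ≤ g x) → 0ℚ ≤ ∑ xs g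
∑-nonneg []       0≤g = QP.≤-refl
∑-nonneg (x ∷ xs) 0≤g = QP.+-mono-≤ (0≤g x) (∑-nonneg xs 0≤g)

∑-mono-≤ : (xs : List A) {g h : A → ℚ} → (∀ x → g x ≤ h x) → ∑ xs g ≤ ∑ xs h
∑-mono-≤ []       g≤h = QP.≤-refl
∑-mono-≤ (x ∷ xs) g≤h = QP.+-mono-≤ (g≤h x) (∑-mono-≤ xs g≤h)

∑-filter : (b : A → Bool) (g : A → ℚ) (xs : List A) →
  sumℚ (map g (filter (λ x → b x Bool.≟ true) xs)) ≡ ∑ xs (λ x → when (b x) (g x))
∑-filter b g []       = refl
∑-filter b g (x ∷ xs) with b x
... | true  = cong (g x +_) (∑-filter b g xs)
... | false = trans (∑-filter b g xs) (sym (QP.+-identityˡ _))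

when-∑ : (b : Bool) (xs : List A) (g : A → ℚ) → when b (∑ xs g) ≡ ∑ xs (λ x → when b (g x))
when-∑ true  xs g = refl
when-∑ false xs g = sym (∑-zero xs)

when-nonneg : (b : Bool) {q : ℚ} → 0ℚ ≤ q → 0ℚ ≤ when b q
when-nonneg true  0≤q = 0≤q
when-nonneg false 0≤q = QP.≤-refl

when-comm : (a b : Bool) (q : ℚ) → when a (when b q) ≡ when b (when a q)
when-comm true  b     q = refl
when-comm false true  q = refl
when-comm false false q = refl

_≟ᵛ_ : {n : ℕ} → DecidableEquality (Vec Bool n)
_≟ᵛ_ = ≡-dec Bool._≟_

∑-allStates-suc : {n : ℕ} (h : Vec Bool (suc n) → ℚ) →
  ∑ (allStates (suc n)) h ≡ ∑ (allStates n) (λ w → h (true ∷ᵛ w) + h (false ∷ᵛ w))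
∑-allStates-suc {n} h = go (allStates n)
  where
  go : (ws : List (Vec Bool n)) →
    ∑ (concatMap (λ w → (true ∷ᵛ w) ∷ (false ∷ᵛ w) ∷ []) ws) h ≡ ∑ ws (λ w → h (true ∷ᵛ w) + h (false ∷ᵛ w))
  go []       = refl
  go (w ∷ ws) = trans (sym (QP.+-assoc (h (true ∷ᵛ w)) (h (false ∷ᵛ w)) _))
                      (cong ((h (true ∷ᵛ w) + h (false ∷ᵛ w)) +_) (go ws))

-- allStates n lists every state exactly once.
∑-allStates-point : {n : ℕ} (v : Vec Bool n) (g : Vec Bool n → ℚ) →
  ∑ (allStates n) (λ w → when (does (v ≟ᵛ w)) (g w)) ≡ g v
∑-allStates-point []ᵛ g = QP.+-identityʳ (g []ᵛ)
∑-allStates-point {suc n} (true ∷ᵛ v) g = begin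
  ∑ (allStates (suc n)) (λ w → when (does ((true ∷ᵛ v) ≟ᵛ w)) (g w))
    ≡⟨ ∑-allStates-suc (λ w → when (does ((true ∷ᵛ v) ≟ᵛ w)) (g w)) ⟩
  ∑ (allStates n) (λ w → when (does (v ≟ᵛ w)) (g (true ∷ᵛ w)) + 0ℚ)
    ≡⟨ ∑-cong (allStates n) (λ _ → QP.+-identityʳ _) ⟩
  ∑ (allStates n) (λ w → when (does (v ≟ᵛ w)) (g (true ∷ᵛ w)))
    ≡⟨ ∑-allStates-point v (g ∘ (true ∷ᵛ_)) ⟩
  g (true ∷ᵛ v) ∎
∑-allStates-point {suc n} (false ∷ᵛ v) g = begin
  ∑ (allStates (suc n)) (λ w → when (does ((false ∷ᵛ v) ≟ᵛ w)) (g w))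
    ≡⟨ ∑-allStates-suc (λ w → when (does ((false ∷ᵛ v) ≟ᵛ w)) (g w)) ⟩
  ∑ (allStates n) (λ w → 0ℚ + when (does (v ≟ᵛ w)) (g (false ∷ᵛ w)))
    ≡⟨ ∑-cong (allStates n) (λ _ → QP.+-identityˡ _) ⟩
  ∑ (allStates n) (λ w → when (does (v ≟ᵛ w)) (g (false ∷ᵛ w)))
    ≡⟨ ∑-allStates-point v (g ∘ (false ∷ᵛ_)) ⟩
  g (false ∷ᵛ v) ∎

stateOf : (V : List ℕ) → (ℕ → Bool) → State V
stateOf []      ρ = []ᵛ
stateOf (y ∷ V) ρ = ρ y ∷ᵛ stateOf V ρ

assign-stateOf : (V : List ℕ) (ρ : ℕ → Bool) {x : ℕ} → x ∈ V → assign V (stateOf V ρ) x ≡ ρ x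
assign-stateOf (y ∷ V) ρ {x} x∈y∷V with x ≡ᵇ y in x≡ᵇy | x∈y∷V
... | true  | _          = cong ρ (sym (≡ᵇ⇒≡ x y (from T-≡ x≡ᵇy)))
... | false | here refl  = ⊥-elim (subst T x≡ᵇy (≡⇒≡ᵇ x x refl))
... | false | there x∈V = assign-stateOf V ρ x∈V

evalᶜ-cong : (ψ : Fml) {ρ ρ′ : ℕ → Bool} → (∀ {x} → x ∈ varsᶠ ψ → ρ x ≡ ρ′ x) → evalᶜ ρ ψ ≡ evalᶜ ρ′ ψ
evalᶜ-cong (var x)   ρ≡ρ′ = ρ≡ρ′ (here refl)
evalᶜ-cong (neg ψ)   ρ≡ρ′ = cong Bool.not (evalᶜ-cong ψ ρ≡ρ′)
evalᶜ-cong (ψ ∧ᶠ ψ′) ρ≡ρ′ =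
  cong₂ Bool._∧_ (evalᶜ-cong ψ (ρ≡ρ′ ∘ ∈-++⁺ˡ)) (evalᶜ-cong ψ′ (ρ≡ρ′ ∘ ∈-++⁺ʳ (varsᶠ ψ)))
evalᶜ-cong (ψ ∨ᶠ ψ′) ρ≡ρ′ =
  cong₂ Bool._∨_ (evalᶜ-cong ψ (ρ≡ρ′ ∘ ∈-++⁺ˡ)) (evalᶜ-cong ψ′ (ρ≡ρ′ ∘ ∈-++⁺ʳ (varsᶠ ψ)))

evalᶜ-stateOf : (V : List ℕ) (ρ : ℕ → Bool) (ψ : Fml) → varsᶠ ψ ⊆ V →
  evalᶜ (assign V (stateOf V ρ)) ψ ≡ evalᶜ ρ ψ
evalᶜ-stateOf V ρ ψ ψ⊆V = evalᶜ-cong ψ (assign-stateOf V ρ ∘ ψ⊆V)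

module _ {V : List ℕ} (M : ProbModel V) where
  open ProbModel M

  measure-∑ : (ψ : Fml) → measure M ψ ≡ ∑ (allStates (length V)) (λ w → when (evalᶜ (assign V w) ψ) (μ w))
  measure-∑ ψ = ∑-filter (λ w → evalᶜ (assign V w) ψ) μ (allStates (length V))

  measure-nonneg : (ψ : Fml) → 0ℚ ≤ measure M ψ
  measure-nonneg ψ = subst (0ℚ ≤_) (sym (measure-∑ ψ))
    (∑-nonneg (allStates (length V)) (λ w → when-nonneg (evalᶜ (assign V w) ψ) (nonneg w)))

  measure-mono : (ψ ψ′ : Fml) → (∀ ρ → evalᶜ ρ ψ ≡ true → evalᶜ ρ ψ′ ≡ true) → measure M ψ ≤ measure M ψ′
  measure-mono ψ ψ′ ψ⊨ψ′ = subst₂ _≤_ (sym (measure-∑ ψ)) (sym (measure-∑ ψ′))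
    (∑-mono-≤ (allStates (length V)) pointwise)
    where
    pointwise : ∀ w → when (evalᶜ (assign V w) ψ) (μ w) ≤ when (evalᶜ (assign V w) ψ′) (μ w)
    pointwise w with evalᶜ (assign V w) ψ in ψ-true
    ... | true  rewrite ψ⊨ψ′ (assign V w) ψ-true = QP.≤-refl
    ... | false = when-nonneg (evalᶜ (assign V w) ψ′) (nonneg w)

pointMass : (V : List ℕ) → State V → ProbModel V
pointMass V v = record
  { μ      = λ w → when (does (v ≟ᵛ w)) 1ℚ
  ; nonneg = λ w → when-nonneg (does (v ≟ᵛ w)) (QP.nonNegative⁻¹ 1ℚ)
  ; total  = ∑-allStates-point v (λ _ → 1ℚ)
  }

measure-pointMass : (V : List ℕ) (v : State V) (ψ : Fml) →
  measure (pointMass V v) ψ ≡ when (evalᶜ (assign V v) ψ) 1ℚ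
measure-pointMass V v ψ = begin
  measure (pointMass V v) ψ
    ≡⟨ measure-∑ (pointMass V v) ψ ⟩
  ∑ S (λ w → when (evalᶜ (assign V w) ψ) (when (does (v ≟ᵛ w)) 1ℚ))
    ≡⟨ ∑-cong S (λ w → when-comm (evalᶜ (assign V w) ψ) (does (v ≟ᵛ w)) 1ℚ) ⟩
  ∑ S (λ w → when (does (v ≟ᵛ w)) (when (evalᶜ (assign V w) ψ) 1ℚ))
    ≡⟨ ∑-allStates-point v (λ w → when (evalᶜ (assign V w) ψ) 1ℚ) ⟩
  when (evalᶜ (assign V v) ψ) 1ℚ ∎
  where
  S : List (State V)
  S = allStates (length V)

measure-pointMass-stateOf : (V : List ℕ) (ρ : ℕ → Bool) (ψ : Fml) → varsᶠ ψ ⊆ V →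
  measure (pointMass V (stateOf V ρ)) ψ ≡ when (evalᶜ ρ ψ) 1ℚ
measure-pointMass-stateOf V ρ ψ ψ⊆V =
  trans (measure-pointMass V (stateOf V ρ) ψ) (cong (λ b → when b 1ℚ) (evalᶜ-stateOf V ρ ψ ψ⊆V))

module _ (V V′ : List ℕ) (M : ProbModel V) where
  open ProbModel M

  private
    S : List (State V)
    S = allStates (length V)

    S′ : List (State V′)
    S′ = allStates (length V′)

    restrict : State V → State V′
    restrict w = stateOf V′ (assign V w)

    fibre : State V′ → State V → ℚ
    fibre w′ w = when (does (restrict w ≟ᵛ w′)) (μ w)

  reindex : ProbModel V′
  reindex = record
    { μ      = λ w′ → ∑ S (fibre w′)
    ; nonneg = λ w′ → ∑-nonneg S (λ w → when-nonneg (does (restrict w ≟ᵛ w′)) (nonneg w))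
    ; total  = begin
        ∑ S′ (λ w′ → ∑ S (fibre w′))          ≡⟨ ∑-swap S′ S fibre ⟩
        ∑ S (λ w → ∑ S′ (λ w′ → fibre w′ w))  ≡⟨ ∑-cong S (λ w → ∑-allStates-point (restrict w) (λ _ → μ w)) ⟩
        ∑ S μ                                 ≡⟨ total ⟩
        1ℚ                                    ∎
    }

  measure-reindex : (ψ : Fml) → varsᶠ ψ ⊆ V′ → measure reindex ψ ≡ measure M ψ
  measure-reindex ψ ψ⊆V′ = begin
    measure reindex ψ
      ≡⟨ measure-∑ reindex ψ ⟩
    ∑ S′ (λ w′ → when (holds′ w′) (∑ S (fibre w′)))
      ≡⟨ ∑-cong S′ (λ w′ → when-∑ (holds′ w′) S (fibre w′)) ⟩
    ∑ S′ (λ w′ → ∑ S (λ w → when (holds′ w′) (fibre w′ w)))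
      ≡⟨ ∑-swap S′ S (λ w′ w → when (holds′ w′) (fibre w′ w)) ⟩
    ∑ S (λ w → ∑ S′ (λ w′ → when (holds′ w′) (fibre w′ w)))
      ≡⟨ ∑-cong S (λ w → ∑-cong S′ (λ w′ → when-comm (holds′ w′) (does (restrict w ≟ᵛ w′)) (μ w))) ⟩
    ∑ S (λ w → ∑ S′ (λ w′ → when (does (restrict w ≟ᵛ w′)) (when (holds′ w′) (μ w))))
      ≡⟨ ∑-cong S (λ w → ∑-allStates-point (restrict w) (λ w′ → when (holds′ w′) (μ w))) ⟩
    ∑ S (λ w → when (holds′ (restrict w)) (μ w))
      ≡⟨ ∑-cong S (λ w → cong (λ b → when b (μ w)) (evalᶜ-stateOf V′ (assign V w) ψ ψ⊆V′)) ⟩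
    ∑ S (λ w → when (evalᶜ (assign V w) ψ) (μ w))
      ≡⟨ measure-∑ M ψ ⟨
    measure M ψ ∎
    where
    holds′ : State V′ → Bool
    holds′ w′ = evalᶜ (assign V′ w′) ψ

1⊓[1-p+q]≡1⇔p≤q : (p q : ℚ) → 1ℚ ⊓ (1ℚ - p + q) ≡ 1ℚ ⇔ p ≤ q
1⊓[1-p+q]≡1⇔p≤q p q = mk⇔ to′ from′
  where
  open +-*-Solver
  p-1+1≡p : (p - 1ℚ) + 1ℚ ≡ p
  p-1+1≡p = solve 1 (λ p → (p :- con 1ℚ) :+ con 1ℚ := p) refl p
  p-1+[1-p+q]≡q : (p - 1ℚ) + (1ℚ - p + q) ≡ q
  p-1+[1-p+q]≡q = solve 2 (λ p q → (p :- con 1ℚ) :+ ((con 1ℚ :- p) :+ q) := q) refl p q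
  1-p+p≡1 : (1ℚ - p) + p ≡ 1ℚ
  1-p+p≡1 = solve 1 (λ p → (con 1ℚ :- p) :+ p := con 1ℚ) refl p

  to′ : 1ℚ ⊓ (1ℚ - p + q) ≡ 1ℚ → p ≤ q
  to′ min≡1 = subst₂ _≤_ p-1+1≡p p-1+[1-p+q]≡q (QP.+-monoʳ-≤ (p - 1ℚ) (QP.p⊓q≡p⇒p≤q min≡1))

  from′ : p ≤ q → 1ℚ ⊓ (1ℚ - p + q) ≡ 1ℚ
  from′ p≤q = QP.p≤q⇒p⊓q≡p (subst (_≤ 1ℚ - p + q) 1-p+p≡1 (QP.+-monoʳ-≤ (1ℚ - p) p≤q))

1-p≡1⇒p≡0 : (p : ℚ) → 1ℚ - p ≡ 1ℚ → p ≡ 0ℚ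
1-p≡1⇒p≡0 p 1-p≡1 = begin
  p                ≡⟨ solve 1 (λ p → p := con 1ℚ :- (con 1ℚ :- p)) refl p ⟩
  1ℚ - (1ℚ - p)    ≡⟨ cong (1ℚ -_) 1-p≡1 ⟩
  0ℚ               ∎
  where open +-*-Solver

module _ {V : List ℕ} (M : ProbModel V) where

  ≈ₚ-holds⇔ : (ψ : Fml) (c : ℚ) → ⟦ ψ ≈ₚ c ⟧ M ≡ 1ℚ ⇔ measure M ψ ≡ c
  ≈ₚ-holds⇔ ψ c = mk⇔ to′ from′
    where
    to′ : ⟦ ψ ≈ₚ c ⟧ M ≡ 1ℚ → measure M ψ ≡ c
    to′ holds with c ≤ᵇ measure M ψ in c≤m | measure M ψ ≤ᵇ c in m≤c | holds
    ... | true  | true  | _ = QP.≤-antisym (QP.≤ᵇ⇒≤ (from T-≡ m≤c)) (QP.≤ᵇ⇒≤ (from T-≡ c≤m))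
    ... | true  | false | ()
    ... | false | true  | ()
    ... | false | false | ()

    from′ : measure M ψ ≡ c → ⟦ ψ ≈ₚ c ⟧ M ≡ 1ℚ
    from′ m≡c rewrite m≡c with c ≤ᵇ c | QP.≤⇒≤ᵇ (QP.≤-refl {c})
    ... | true  | _  = refl
    ... | false | ()

  ¬△¬Pr-holds⇔ : (ψ : Fml) → ⟦ ¬ₚ (△ (¬ₚ Pr ψ)) ⟧ M ≡ 1ℚ ⇔ 0ℚ < measure M ψ
  ¬△¬Pr-holds⇔ ψ with (1ℚ - measure M ψ) ≟ 1ℚ
  ... | yes 1-m≡1 = mk⇔ (λ ()) (λ 0<m → ⊥-elim (QP.<⇒≢ 0<m (sym (1-p≡1⇒p≡0 (measure M ψ) 1-m≡1))))
  ... | no 1-m≢1 = mk⇔ (λ _ → positive) (λ _ → refl)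
    where
    positive : 0ℚ < measure M ψ
    positive with 0ℚ <? measure M ψ
    ... | yes 0<m = 0<m
    ... | no 0≮m = ⊥-elim (1-m≢1 (cong (1ℚ -_) (QP.≤-antisym (QP.≮⇒≥ 0≮m) (measure-nonneg M ψ))))

  ⇒-holds⇔ : (α β : PrF) → ⟦ α ⇒ β ⟧ M ≡ 1ℚ ⇔ ⟦ α ⟧ M ≤ ⟦ β ⟧ M
  ⇒-holds⇔ α β = 1⊓[1-p+q]≡1⇔p≤q (⟦ α ⟧ M) (⟦ β ⟧ M)

_⊨_ : {V : List ℕ} → ProbModel V → List PrF → Set
M ⊨ Γ = All (λ α → ⟦ α ⟧ M ≡ 1ℚ) Γ

⟦⟧-reindex : (V V′ : List ℕ) (M : ProbModel V) (α : PrF) → varsᴾ α ⊆ V′ →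
  ⟦ α ⟧ (reindex V V′ M) ≡ ⟦ α ⟧ M
⟦⟧-reindex V V′ M (Pr ψ)      α⊆V′ = measure-reindex V V′ M ψ α⊆V′
⟦⟧-reindex V V′ M (Prc ψ d c) α⊆V′ = cong (λ m → ind (cmpᵇ d m c)) (measure-reindex V V′ M ψ α⊆V′)
⟦⟧-reindex V V′ M (¬ₚ α)      α⊆V′ = cong (1ℚ -_) (⟦⟧-reindex V V′ M α α⊆V′)
⟦⟧-reindex V V′ M (△ α)       α⊆V′ = cong (λ q → ind ⌊ q ≟ 1ℚ ⌋) (⟦⟧-reindex V V′ M α α⊆V′)
⟦⟧-reindex V V′ M (α ⊙ β)     α⊆V′ = cong₂ (λ a b → 0ℚ ⊔ (a + b - 1ℚ))
  (⟦⟧-reindex V V′ M α (α⊆V′ ∘ ∈-++⁺ˡ)) (⟦⟧-reindex V V′ M β (α⊆V′ ∘ ∈-++⁺ʳ (varsᴾ α)))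
⟦⟧-reindex V V′ M (α ⊕ β)     α⊆V′ = cong₂ (λ a b → 1ℚ ⊓ (a + b))
  (⟦⟧-reindex V V′ M α (α⊆V′ ∘ ∈-++⁺ˡ)) (⟦⟧-reindex V V′ M β (α⊆V′ ∘ ∈-++⁺ʳ (varsᴾ α)))
⟦⟧-reindex V V′ M (α ⇒ β)     α⊆V′ = cong₂ (λ a b → 1ℚ ⊓ (1ℚ - a + b))
  (⟦⟧-reindex V V′ M α (α⊆V′ ∘ ∈-++⁺ˡ)) (⟦⟧-reindex V V′ M β (α⊆V′ ∘ ∈-++⁺ʳ (varsᴾ α)))

⊨-reindex : (V V′ : List ℕ) (M : ProbModel V) {Γ : List PrF} →
  (∀ {α} → α ∈ Γ → varsᴾ α ⊆ V′) → M ⊨ Γ → reindex V V′ M ⊨ Γ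
⊨-reindex V V′ M Γ⊆V′ M⊨Γ =
  All.tabulate (λ {α} α∈Γ → trans (⟦⟧-reindex V V′ M α (Γ⊆V′ α∈Γ)) (All.lookup M⊨Γ α∈Γ))

++-⊆ : {xs ys zs : List A} → xs ⊆ zs → ys ⊆ zs → xs ++ ys ⊆ zs
++-⊆ {xs = xs} xs⊆zs ys⊆zs = [ xs⊆zs , ys⊆zs ] ∘ ∈-++⁻ xs

varsᴾ⊆varsΓ : {α : PrF} {Γ : List PrF} → α ∈ Γ → varsᴾ α ⊆ varsΓ Γ
varsᴾ⊆varsΓ             (here refl) = ∈-++⁺ˡ
varsᴾ⊆varsΓ {Γ = β ∷ Γ} (there α∈Γ) = ∈-++⁺ʳ (varsᴾ β) ∘ varsᴾ⊆varsΓ α∈Γ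

FPSat⇔satisfiableOver : (Γ : List PrF) (V : List ℕ) → (∀ {α} → α ∈ Γ → varsᴾ α ⊆ V) →
  FPSat Γ ⇔ Σ (ProbModel V) (_⊨ Γ)
FPSat⇔satisfiableOver Γ V Γ⊆V = mk⇔
  (λ (M , M⊨Γ) → reindex (varsΓ Γ) V M , ⊨-reindex (varsΓ Γ) V M Γ⊆V M⊨Γ)
  (λ (M , M⊨Γ) → reindex V (varsΓ Γ) M , ⊨-reindex V (varsΓ Γ) M varsᴾ⊆varsΓ M⊨Γ)

∧≡true⁻ : {a b : Bool} → a Bool.∧ b ≡ true → a ≡ true × b ≡ true
∧≡true⁻ {true} b≡true = refl , b≡true

1≤when⇒true : (b : Bool) → 1ℚ ≤ when b 1ℚ → b ≡ true
1≤when⇒true true  _   = refl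
1≤when⇒true false 1≤0 = ⊥-elim (QP.<-irrefl refl (QP.<-≤-trans (QP.positive⁻¹ 1ℚ) 1≤0))

FPValid⇔⊨CPL : (φ τ χ : Fml) → FPValid (Pr (φ ∧ᶠ τ) ⇒ Pr χ) ⇔ (φ , τ ⊨CPL χ)
FPValid⇔⊨CPL φ τ χ = mk⇔ to′ from′
  where
  to′ : FPValid (Pr (φ ∧ᶠ τ) ⇒ Pr χ) → φ , τ ⊨CPL χ
  to′ valid ρ φ-true τ-true = 1≤when⇒true (evalᶜ ρ χ) (subst₂ _≤_ δρ[φ∧τ]≡1 δρ[χ]≡ρ[χ] δρ[φ∧τ]≤δρ[χ])
    where
    V : List ℕ
    V = varsᶠ (φ ∧ᶠ τ) ++ varsᶠ χ

    δρ : ProbModel V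
    δρ = pointMass V (stateOf V ρ)

    δρ[φ∧τ]≤δρ[χ] : measure δρ (φ ∧ᶠ τ) ≤ measure δρ χ
    δρ[φ∧τ]≤δρ[χ] = to (⇒-holds⇔ δρ (Pr (φ ∧ᶠ τ)) (Pr χ)) (valid V (All.tabulate (λ x∈V → x∈V)) δρ)

    δρ[φ∧τ]≡1 : measure δρ (φ ∧ᶠ τ) ≡ 1ℚ
    δρ[φ∧τ]≡1 = trans (measure-pointMass-stateOf V ρ (φ ∧ᶠ τ) ∈-++⁺ˡ)
                      (cong (λ b → when b 1ℚ) (cong₂ Bool._∧_ φ-true τ-true))

    δρ[χ]≡ρ[χ] : measure δρ χ ≡ when (evalᶜ ρ χ) 1ℚ
    δρ[χ]≡ρ[χ] = measure-pointMass-stateOf V ρ χ (∈-++⁺ʳ (varsᶠ (φ ∧ᶠ τ)))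

  from′ : φ , τ ⊨CPL χ → FPValid (Pr (φ ∧ᶠ τ) ⇒ Pr χ)
  from′ φ,τ⊨χ V _ M = from (⇒-holds⇔ M (Pr (φ ∧ᶠ τ)) (Pr χ))
    (measure-mono M (φ ∧ᶠ τ) χ (λ ρ φ∧τ-true →
       let (φ-true , τ-true) = ∧≡true⁻ φ∧τ-true in φ,τ⊨χ ρ φ-true τ-true))

module _ (P : PrAP) where
  open PrAP P

  φχ⊆varsP : varsᶠ φ ++ varsᶠ χ ⊆ varsP P
  φχ⊆varsP = ++-⊆ (xs⊆xs++ys (varsᶠ φ) _) (xs⊆ys++xs _ (varsᶠ φ) ∘ xs⊆xs++ys (varsᶠ χ) _)

  term⊆varsP : {τ : Fml} → IsTermOver H τ → varsᶠ τ ⊆ varsP P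
  term⊆varsP (lit {pos x}  l∈H) (here refl) = φχ⊆varsP (All.lookup H-vars l∈H)
  term⊆varsP (lit {negl x} l∈H) (here refl) = φχ⊆varsP (All.lookup H-vars l∈H)
  term⊆varsP (conj τ-term τ′-term)           = ++-⊆ (term⊆varsP τ-term) (term⊆varsP τ′-term)

  Ξ⊆varsP : {β : PrF} → β ∈ Ξ P → varsᴾ β ⊆ varsP P
  Ξ⊆varsP β∈Ξ with ∈-map⁻ (λ ψ → ψ ≈ₚ 𝔭 ψ) β∈Ξ
  ... | ψ , ψ∈E , refl = ++-⊆ ψ⊆varsP ψ⊆varsP
    where
    ψ⊆varsP : varsᶠ ψ ⊆ varsP P
    ψ⊆varsP = φχ⊆varsP ∘ All.lookup (All.lookup E-vars ψ∈E)

  ⊨Ξ⇔coherent : {V : List ℕ} (M : ProbModel V) → M ⊨ Ξ P ⇔ All (λ ψ → measure M ψ ≡ 𝔭 ψ) E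
  ⊨Ξ⇔coherent M = mk⇔
    (All.map (λ {ψ} → to (≈ₚ-holds⇔ M ψ (𝔭 ψ))) ∘ All.map⁻)
    (All.map⁺ ∘ All.map (λ {ψ} → from (≈ₚ-holds⇔ M ψ (𝔭 ψ))))

  FPSat-Ξ∷⇔ : (α : PrF) → varsᴾ α ⊆ varsP P →
    FPSat (Ξ P ++ α ∷ []) ⇔ Σ (ProbModel (varsP P)) (λ M → Coherent P M × ⟦ α ⟧ M ≡ 1ℚ)
  FPSat-Ξ∷⇔ α α⊆varsP = mk⇔
    (λ sat → let (M , M⊨Γ) = to sat⇔ sat in
       M , to (⊨Ξ⇔coherent M) (All.++⁻ˡ (Ξ P) M⊨Γ) , All.head (All.++⁻ʳ (Ξ P) M⊨Γ))
    (λ (M , coherent , α-holds) →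
       from sat⇔ (M , All.++⁺ (from (⊨Ξ⇔coherent M) coherent) (α-holds All.∷ All.[])))
    where
    Γ⊆varsP : {β : PrF} → β ∈ Ξ P ++ α ∷ [] → varsᴾ β ⊆ varsP P
    Γ⊆varsP β∈Γ with ∈-++⁻ (Ξ P) β∈Γ
    ... | inj₁ β∈Ξ         = Ξ⊆varsP β∈Ξ
    ... | inj₂ (here refl) = α⊆varsP

    sat⇔ : FPSat (Ξ P ++ α ∷ []) ⇔ Σ (ProbModel (varsP P)) (_⊨ (Ξ P ++ α ∷ []))
    sat⇔ = FPSat⇔satisfiableOver (Ξ P ++ α ∷ []) (varsP P) Γ⊆varsP

  SolutionInFP : Fml → Set
  SolutionInFP τ = FPSat (Ξ P ++ (¬ₚ (△ (¬ₚ Pr (φ ∧ᶠ τ)))) ∷ []) × FPValid (Pr (φ ∧ᶠ τ) ⇒ Pr χ)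

  PreferredInFP : Fml → Set
  PreferredInFP τ = SolutionInFP τ × ((σ : Fml) → IsSolution P σ → FPSat (Ξ P ++ (Pr σ ⇒ Pr τ) ∷ []))

  IsSolution⇔SolutionInFP : {τ : Fml} → IsTermOver H τ → IsSolution P τ ⇔ SolutionInFP τ
  IsSolution⇔SolutionInFP {τ} τ-term = mk⇔
    (λ (_ , φ,τ⊨χ , M , coherent , positive) →
       from sat⇔ (M , coherent , from (¬△¬Pr-holds⇔ M (φ ∧ᶠ τ)) positive) , from (FPValid⇔⊨CPL φ τ χ) φ,τ⊨χ)
    (λ (sat , valid) → let (M , coherent , holds) = to sat⇔ sat in
       τ-term , to (FPValid⇔⊨CPL φ τ χ) valid , M , coherent , to (¬△¬Pr-holds⇔ M (φ ∧ᶠ τ)) holds)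
    where
    sat⇔ : FPSat (Ξ P ++ (¬ₚ (△ (¬ₚ Pr (φ ∧ᶠ τ)))) ∷ []) ⇔
      Σ (ProbModel (varsP P)) (λ M → Coherent P M × ⟦ ¬ₚ (△ (¬ₚ Pr (φ ∧ᶠ τ))) ⟧ M ≡ 1ℚ)
    sat⇔ = FPSat-Ξ∷⇔ (¬ₚ (△ (¬ₚ Pr (φ ∧ᶠ τ)))) (++-⊆ (φχ⊆varsP ∘ ∈-++⁺ˡ) (term⊆varsP τ-term))

  IsPreferred⇔PreferredInFP : {τ : Fml} → IsTermOver H τ → IsPreferred P τ ⇔ PreferredInFP τ
  IsPreferred⇔PreferredInFP {τ} τ-term = mk⇔
    (λ (solution , dominates) → to (IsSolution⇔SolutionInFP τ-term) solution , λ σ σ-solution →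
       let (M , coherent , σ≤τ) = dominates σ σ-solution in
       from (sat⇔ σ-solution) (M , coherent , from (⇒-holds⇔ M (Pr σ) (Pr τ)) σ≤τ))
    (λ (solution , sat) → from (IsSolution⇔SolutionInFP τ-term) solution , λ σ σ-solution →
       let (M , coherent , holds) = to (sat⇔ σ-solution) (sat σ σ-solution) in
       M , coherent , to (⇒-holds⇔ M (Pr σ) (Pr τ)) holds)
    where
    sat⇔ : {σ : Fml} → IsSolution P σ →
      FPSat (Ξ P ++ (Pr σ ⇒ Pr τ) ∷ []) ⇔ Σ (ProbModel (varsP P)) (λ M → Coherent P M × ⟦ Pr σ ⇒ Pr τ ⟧ M ≡ 1ℚ)
    sat⇔ (σ-term , _) = FPSat-Ξ∷⇔ (Pr _ ⇒ Pr τ) (++-⊆ (term⊆varsP σ-term) (term⊆varsP τ-term))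

theorem10 : (P : PrAP) (τ : Fml) → IsTermOver (PrAP.H P) τ →
    (IsSolution P τ ⇔
       (FPSat (Ξ P ++ (¬ₚ (△ (¬ₚ Pr (PrAP.φ P ∧ᶠ τ)))) ∷ [])
        × FPValid (Pr (PrAP.φ P ∧ᶠ τ) ⇒ Pr (PrAP.χ P))))
    × (IsPreferred P τ ⇔
       ((FPSat (Ξ P ++ (¬ₚ (△ (¬ₚ Pr (PrAP.φ P ∧ᶠ τ)))) ∷ [])
         × FPValid (Pr (PrAP.φ P ∧ᶠ τ) ⇒ Pr (PrAP.χ P)))
        × ((σ : Fml) → IsSolution P σ → FPSat (Ξ P ++ (Pr σ ⇒ Pr τ) ∷ []))))
theorem10 P τ τ-term = IsSolution⇔SolutionInFP P τ-term , IsPreferred⇔PreferredInFP P τ-term
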